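{- Let $\mathbf{2}=\{\mathbf{0},\mathbf{1}\}$ and define $\beta:\mathrm{Alt}(\mathbf{2})\to\mathbf{2}$ by $\beta(S)=\mathbf{1}$ if $\{\mathbf{1}\}\in S$ and $\beta(S)=\mathbf{0}$ otherwise. Then $(\mathbf{2},\beta)$ is an Eilenberg–Moore algebra for the monad $(\mathrm{Alt},\eta,\mu)$. That is, $\beta\circ\eta_{\mathbf{2}}=\mathrm{id}_{\mathbf{2}}$ and $\beta\circ\mu_{\mathbf{2}}=\beta\circ\mathrm{Alt}(\beta)$.
   Context: $\mathrm{Alt}$ is the following monad on $\mathbf{Set}$. - Objects: for a set $X$, $\mathrm{Alt}(X)$ is the set of families $S\subseteq\mathcal{P}(X)$ of subsets of $X$ that are upward closed under inclusion (if $s\in S$ and $s\subseteq t\subseteq X$ then $t\in S$). - Arrows: for $f:X\to Y$, $\mathrm{Alt}(f)(S)=\{T\subseteq Y\mid\exists s\in S,\ f(s)\subseteq T\}$, where $f(s)$ is the direct image. - Unit: $\eta_X(x)=\{T\subseteq X\mid x\in T\}$. - Multiplication: for $S\in\mathrm{Alt}(\mathrm{Alt}(X))$, $\mu_X(S)=\{T\subseteq X\mid \exists s\in S\ \forall t\in s\ \exists u\in t\ \forall v\in u,\ v\in T\}$. This monad is obtained as $\mathcal{U}\circ\mathrm{Up}\circ\mathrm{Dn}\circ\mathrm{Do}$ from the upset and downset monads on posets, the distributive law $\lambda_X(S)=\{T\mid\forall s\in S,\ s\cap T\neq\emptyset\}$, and the discrete-order/forgetful adjunction. -}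

module Defs where

open import Data.Bool using (Bool; true; false)
open import Data.Product using (Σ; _×_; _,_; proj₁; proj₂)
open import Relation.Nullary using (Dec; yes; no; ¬_)
open import Relation.Binary.PropositionalEquality using (_≡_; refl)
open import Data.Empty using (⊥-elim)

Sub : Set → Set
Sub X = X → Bool

infix 4 _∈_ _⊆_

_∈_ : {X : Set} → X → Sub X → Set
x ∈ s = s x ≡ true

_⊆_ : {X : Set} → Sub X → Sub X → Set
s ⊆ t = ∀ x → x ∈ s → x ∈ t

UpClosed : {X : Set} → Sub (Sub X) → Set
UpClosed {X} S = (s t : Sub X) → s ∈ S → s ⊆ t → t ∈ S

record Alt (X : Set) : Set where
  constructor mkAlt
  field
    fam : Sub (Sub X)
    up  : UpClosed fam
open Alt public

-- The two-element set 2 = {0,1} is Bool with 0 = false, 1 = true.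
-- The singleton subset {1} of 2 (its characteristic function is the identity).
｛𝟏｝ : Sub Bool
｛𝟏｝ b = b

β : Alt Bool → Bool
β S = fam S ｛𝟏｝

-- Law of excluded middle (the ambient metatheory of Set is classical).
LEM : Set₁
LEM = (P : Set) → Dec P

module WithLEM (lem : LEM) where

  ⌊_⌋ : Set → Bool
  ⌊ P ⌋ with lem P
  ... | yes _ = true
  ... | no  _ = false

  ⌊⌋-sound : {P : Set} → ⌊ P ⌋ ≡ true → P
  ⌊⌋-sound {P} e with lem P
  ... | yes p = p
  ⌊⌋-sound {P} () | no _

  ⌊⌋-complete : {P : Set} → P → ⌊ P ⌋ ≡ true
  ⌊⌋-complete {P} p with lem P
  ... | yes _ = refl
  ... | no ¬p = ⊥-elim (¬p p)

  η : {X : Set} → X → Alt X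
  η x = mkAlt (λ T → T x) (λ s t xs s⊆t → s⊆t x xs)

  AltMapProp : {X Y : Set} → (X → Y) → Alt X → Sub Y → Set
  AltMapProp {X} f S T = Σ (Sub X) λ s → s ∈ fam S × (∀ x → x ∈ s → f x ∈ T)

  Alt-map : {X Y : Set} → (X → Y) → Alt X → Alt Y
  Alt-map f S = mkAlt (λ T → ⌊ AltMapProp f S T ⌋)
    (λ T T' h T⊆T' → ⌊⌋-complete
       (let (s , s∈S , fs⊆T) = ⌊⌋-sound h
        in s , s∈S , λ x x∈s → T⊆T' (f x) (fs⊆T x x∈s)))

  μProp : {X : Set} → Alt (Alt X) → Sub X → Set
  μProp {X} S T =
    Σ (Sub (Alt X)) λ s → s ∈ fam S ×
      (∀ t → t ∈ s → Σ (Sub X) λ u → u ∈ fam t × (∀ v → v ∈ u → v ∈ T))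

  μ : {X : Set} → Alt (Alt X) → Alt X
  μ S = mkAlt (λ T → ⌊ μProp S T ⌋)
    (λ T T' h T⊆T' → ⌊⌋-complete
       (let (s , s∈S , k) = ⌊⌋-sound h
        in s , s∈S , λ t t∈s →
             let (u , u∈t , u⊆T) = k t t∈s
             in u , u∈t , λ v v∈u → T⊆T' v (u⊆T v v∈u)))

module Submission where

open import Defs
open import Data.Bool using (Bool; true; false)
open import Data.Product using (_×_; _,_)
open import Function.Bundles using (_⇔_; mk⇔; module Equivalence)
open import Relation.Binary.PropositionalEquality using (_≡_; refl; sym; trans)

-- For the multiplication law, both sides decide whether
-- {1} belongs to a family; the two membership conditions are equivalent because a
-- witness u ⊆ {1} with u ∈ t yields {1} ∈ t by upward closure of t, and conversely
-- u = {1} is a witness.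

module _ (lem : LEM) where
  open WithLEM lem

  ⌊⌋-cong : {P Q : Set} → P ⇔ Q → ⌊ P ⌋ ≡ ⌊ Q ⌋
  ⌊⌋-cong {P} {Q} P⇔Q with ⌊ P ⌋ in eP | ⌊ Q ⌋ in eQ
  ... | true  | true  = refl
  ... | false | false = refl
  ... | true  | false = sym (trans (sym eQ) (⌊⌋-complete (to (⌊⌋-sound eP))))
    where open Equivalence P⇔Q
  ... | false | true  = trans (sym eP) (⌊⌋-complete (from (⌊⌋-sound eQ)))
    where open Equivalence P⇔Q

  μProp-｛𝟏｝⇔AltMapProp-β : (S : Alt (Alt Bool)) → μProp S ｛𝟏｝ ⇔ AltMapProp β S ｛𝟏｝
  μProp-｛𝟏｝⇔AltMapProp-β S = mk⇔ to from
    where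
    to : μProp S ｛𝟏｝ → AltMapProp β S ｛𝟏｝
    to (s , s∈S , k) = s , s∈S , λ t t∈s →
      let (u , u∈t , u⊆｛𝟏｝) = k t t∈s in up t u ｛𝟏｝ u∈t u⊆｛𝟏｝

    from : AltMapProp β S ｛𝟏｝ → μProp S ｛𝟏｝
    from (s , s∈S , k) = s , s∈S , λ t t∈s → ｛𝟏｝ , k t t∈s , λ _ v∈｛𝟏｝ → v∈｛𝟏｝

mainTheorem7 : (lem : LEM) → let open WithLEM lem in
    ((x : Bool) → β (η x) ≡ x) × ((S : Alt (Alt Bool)) → β (μ S) ≡ β (Alt-map β S))
mainTheorem7 lem = (λ x → refl) , λ S → ⌊⌋-cong lem (μProp-｛𝟏｝⇔AltMapProp-β lem S)
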